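{- Let $s$ be a string with Lyndon runs $F_1,\dots,F_m$ and let $\mathrm{dom}_{d+p-1}(F_i),\dots,\mathrm{dom}_d(F_{i+p-1})$ be a $p$-group with $p\ge2$. Then the substring of $s$ associated with this $p$-group contains at least $p-1$ different LZ77 phrase boundaries.
   Context: Let $s=f_1^{e_1}\cdots f_m^{e_m}$ be the Lyndon factorization of $s$ (each $f_i$ a Lyndon word, i.e. a nonempty string strictly lexicographically smaller than all its nonempty proper suffixes; $e_i\ge1$; $f_i\succ f_{i+1}$) and $F_i=f_i^{e_i}$ the Lyndon runs, viewed as consecutive substrings of $s$. For $d\ge1$, $1\le i\le m-d+1$, the leftmost occurrence of $F_i\cdots F_{i+d-1}$ in $s$ begins at the first position of some run $F_j$, $j\le i$; $\mathrm{dom}_d(F_i)=F_j\cdots F_{i-1}$ (empty if $j=i$) and $\mathrm{extdom}_d(F_i)=F_j\cdots F_{i+d-1}$, as substrings (positions) of $s$. For $d\ge1$, $p\ge2$, $1\le i\le m-d-p+2$, the domains $\mathrm{dom}_{d+p-1}(F_i),\dots,\mathrm{dom}_d(F_{i+p-1})$ form a $p$-group if $\mathrm{extdom}_{d+p-1}(F_i)=\mathrm{extdom}_{d+p-2}(F_{i+1})=\cdots=\mathrm{extdom}_d(F_{i+p-1})$. Then $F_{i+p-1}\cdots F_{i+p+d-2}$ is a prefix of $F_i$, so the leftmost occurrence of $F_i\cdots F_{i+p+d-2}$ in $s$ can be written as $F_{i+p-1}\cdots F_{i+p+d-2}\,x\,F_{i+1}\cdots F_{i+p+d-2}$; the occurrence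 of $xF_{i+1}\cdots F_{i+p+d-2}$ forming its suffix is the substring associated with the $p$-group. The non-overlapping LZ factorization $s=p_1\cdots p_z$ is built greedily left to right: each phrase $p_t$ is either the leftmost occurrence of a letter, or the longest prefix of $p_t\cdots p_z$ occurring as a substring of $p_1\cdots p_{t-1}$. An LZ77 phrase boundary is the starting position of a phrase; a substring contains it if the position lies within the substring. -}

module Defs where

open import Data.Nat using (ℕ; zero; suc; _+_; _∸_; _≤_; _<_)
open import Data.List using (List; []; _∷_; _++_; length; concat; map; replicate; take; drop)
open import Data.List.Membership.Propositional using (_∈_; _∉_)
open import Data.List.Relation.Binary.Lex.Strict using (Lex-<)
open import Data.List.Relation.Unary.All using (All)
open import Data.List.Relation.Unary.Linked using (Linked)
open import Data.List.Relation.Unary.Unique.Propositional using (Unique)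
open import Data.Product using (Σ; ∃; _×_; _,_)
open import Data.Sum using (_⊎_)
open import Data.Unit using (⊤)
open import Relation.Binary.PropositionalEquality using (_≡_; _≢_)

Str : Set
Str = List ℕ

_≺_ : Str → Str → Set
u ≺ v = Lex-< _≡_ _<_ u v

Lyndon : Str → Set
Lyndon f = f ≢ [] × (∀ u v → f ≡ u ++ v → u ≢ [] → v ≢ [] → f ≺ v)

pow : Str → ℕ → Str
pow f e = concat (replicate e f)

runs : List (Str × ℕ) → List Str
runs fs = map (λ { (f , e) → pow f e }) fs

IsLyndonFactorization : Str → List (Str × ℕ) → Set
IsLyndonFactorization s fs =
  All (λ { (f , e) → Lyndon f × 1 ≤ e }) fs
  × Linked (λ { (f , _) (g , _) → g ≺ f }) fs
  × concat (runs fs) ≡ s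

-- w occurs in s starting at (0-based) position q
OccursAt : Str → Str → ℕ → Set
OccursAt w s q = Σ Str λ u → Σ Str λ v → length u ≡ q × s ≡ u ++ w ++ v

LeftmostOcc : Str → Str → ℕ → Set
LeftmostOcc w s q = OccursAt w s q × (∀ q′ → OccursAt w s q′ → q ≤ q′)

-- concatenation F_i ⋯ F_{i+n-1} of n consecutive runs (0-based index i)
block : List Str → ℕ → ℕ → Str
block Fs i n = concat (take n (drop i Fs))

Substr : Str → Str → Set
Substr w t = Σ Str λ u → Σ Str λ v → t ≡ u ++ w ++ v

Prefix : Str → Str → Set
Prefix w t = Σ Str λ v → t ≡ w ++ v

-- One greedy LZ step: P = p_1⋯p_{t-1}, x = p_t, R = p_t⋯p_z.
LZStep : Str → Str → Str → Set
LZStep P x R =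
  (Σ ℕ λ c → x ≡ c ∷ [] × c ∉ P)
  ⊎ (x ≢ [] × Substr x P × (∀ w → Prefix w R → Substr w P → length w ≤ length x))

LZFrom : Str → List Str → Set
LZFrom P [] = ⊤
LZFrom P (x ∷ ps) = LZStep P x (concat (x ∷ ps)) × LZFrom (P ++ x) ps

-- Non-overlapping LZ77 factorization s = p_1 ⋯ p_z
IsLZ : Str → List Str → Set
IsLZ s ps = concat ps ≡ s × LZFrom [] ps

starts : ℕ → List Str → List ℕ
starts n [] = []
starts n (x ∷ xs) = n ∷ starts (n + length x) xs

phraseBoundaries : List Str → List ℕ
phraseBoundaries ps = starts 0 ps

-- Write B k = F (i+k) ⋯ F (i+N-1) with N = d + p - 1, so that B k = F (i+k) ++ B (k+1) and,
-- by the p-group hypothesis, every B k has its leftmost occurrence at q. The Lyndon root g of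
-- F (i+k) is strictly greater than every later root, so g is not a prefix of B (k+1); as both
-- F (i+k) ++ B (k+1) and B (k+1) start at q, this forces |B (k+1)| < |F (i+k)|. Now take the
-- LZ phrase covering the last position of the occurrence of B k. If it started before
-- q + |B (k+1)| it would contain the occurrence of B (k+1) at q + |F (i+k)|, and its earlier
-- (non-overlapping) copy would contain an occurrence of B (k+1) left of q. So every interval
-- [q + |B (k+1)|, q + |B k|), k < p - 1, holds a phrase boundary, and these intervals are disjoint.
module Submission where

open import Defs
open import Data.Nat using (ℕ; zero; suc; _+_; _∸_; _≤_; _<_; z≤n; s≤s; _≤?_; _<?_)
open import Data.Nat.Properties
open import Data.Nat.Tactic.RingSolver using (solve-∀)
open import Data.List using (List; []; _∷_; _++_; length; concat; take; drop)
open import Data.List.Properties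
  using (++-assoc; ++-identityʳ; ++-conicalˡ; ∷-injectiveˡ; ∷-injectiveʳ; length-++; length-take; length-drop; drop-map; take++drop≡id; concat-++)
open import Data.List.Relation.Binary.Lex.Strict using (<-transitive)
open import Data.List.Relation.Binary.Lex.Core using (halt; this; next)
open import Data.List.Membership.Propositional using (_∈_)
open import Data.List.Relation.Unary.Any using (here; there)
open import Data.List.Relation.Unary.All as All using (All; []; _∷_)
import Data.List.Relation.Unary.All.Properties as All
open import Data.List.Relation.Unary.AllPairs as AllPairs using (AllPairs; []; _∷_)
import Data.List.Relation.Unary.AllPairs.Properties as AllPairs
open import Data.List.Relation.Unary.Linked.Properties using (Linked⇒AllPairs)
open import Data.List.Relation.Unary.Unique.Propositional using (Unique)
open import Data.Product using (Σ; _×_; _,_; proj₁; proj₂)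
open import Data.Sum using (_⊎_; inj₁; inj₂)
open import Data.Empty using (⊥; ⊥-elim)
open import Relation.Nullary using (¬_; yes; no)
open import Relation.Binary.Definitions using (Transitive)
open import Relation.Binary.PropositionalEquality

≺-trans : Transitive _≺_
≺-trans = <-transitive isEquivalence (resp₂ _<_) <-trans

≺-common-prefix : ∀ {h y v T : Str} → h ≺ y → y ++ v ≡ h ++ T →
                  Σ Str λ y′ → y′ ≢ [] × y ≡ h ++ y′ × y′ ++ v ≡ T
≺-common-prefix {y = c ∷ y} halt eq = c ∷ y , (λ ()) , refl , eq
≺-common-prefix (this a<b) eq = ⊥-elim (<-irrefl (sym (∷-injectiveˡ eq)) a<b)
≺-common-prefix {a ∷ _} (next refl h≺y) eq with ≺-common-prefix h≺y (∷-injectiveʳ eq)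
... | y′ , y′≢[] , y≡ , T≡ = y′ , y′≢[] , cong (a ∷_) y≡ , T≡

data Concat≺ (g : Str) : Str → Set where
  []  : Concat≺ g []
  _∷_ : ∀ {h T} → h ≺ g → Concat≺ g T → Concat≺ g (h ++ T)

≺-lyndon-suffix : ∀ {g h} → Lyndon g → h ≺ g → ∀ z {y} → g ≡ z ++ y → y ≢ [] → h ≺ y
≺-lyndon-suffix _  h≺g []      refl _    = h≺g
≺-lyndon-suffix ly h≺g (c ∷ z) g≡ y≢[] = ≺-trans h≺g (proj₂ ly (c ∷ z) _ g≡ (λ ()) y≢[])

-- Each piece h ≺ g is also ≺ y, so it is a proper prefix of y, and what remains of y
-- is a shorter nonempty suffix of g.
lyndon-suffix-¬prefix : ∀ {g T} → Lyndon g → ∀ z y → g ≡ z ++ y → y ≢ [] →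
                        Concat≺ g T → ¬ Prefix y T
lyndon-suffix-¬prefix _ _ y _ y≢[] [] (v , []≡) = y≢[] (++-conicalˡ y v (sym []≡))
lyndon-suffix-¬prefix {g} ly z y g≡ y≢[] (_∷_ {h} h≺g pieces) (v , T≡)
  with ≺-common-prefix (≺-lyndon-suffix ly h≺g z g≡ y≢[]) (sym T≡)
... | y′ , y′≢[] , y≡ , T′≡ =
  lyndon-suffix-¬prefix ly (z ++ h) y′ g≡′ y′≢[] pieces (v , sym T′≡)
  where
  g≡′ : g ≡ (z ++ h) ++ y′
  g≡′ = trans g≡ (trans (cong (z ++_) y≡) (sym (++-assoc z h y′)))

lyndon-¬prefix : ∀ {g T} → Lyndon g → Concat≺ g T → ¬ Prefix g T
lyndon-¬prefix ly = lyndon-suffix-¬prefix ly [] _ refl (proj₁ ly)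

pow-Concat≺ : ∀ {f g T} e → f ≺ g → Concat≺ g T → Concat≺ g (pow f e ++ T)
pow-Concat≺ zero _ pieces = pieces
pow-Concat≺ {f} {g} {T} (suc e) f≺g pieces =
  subst (Concat≺ g) (sym (++-assoc f (pow f e) T)) (f≺g ∷ pow-Concat≺ e f≺g pieces)

runs-Concat≺ : ∀ {g} fs → All (λ fe → proj₁ fe ≺ g) fs → Concat≺ g (concat (runs fs))
runs-Concat≺ []             []          = []
runs-Concat≺ ((_ , e) ∷ fs) (f≺g ∷ f≺gs) = pow-Concat≺ e f≺g (runs-Concat≺ fs f≺gs)

++-split : ∀ {A : Set} (xs ys zs ws : List A) → xs ++ ys ≡ zs ++ ws → length xs ≤ length zs →
           Σ (List A) λ m → zs ≡ xs ++ m × ys ≡ m ++ ws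
++-split []       ys zs       ws eq _         = zs , refl , eq
++-split (x ∷ xs) ys (z ∷ zs) ws eq (s≤s xs≤zs)
  with ∷-injectiveˡ eq | ++-split xs ys zs ws (∷-injectiveʳ eq) xs≤zs
... | refl | m , zs≡ , ys≡ = m , cong (x ∷_) zs≡ , ys≡

-- Otherwise g would be a prefix of T.
run-longer : ∀ {g e T B x y} → Lyndon g → 1 ≤ e → Concat≺ g T → Prefix B T →
             pow g e ++ x ≡ B ++ y → length B < length (pow g e)
run-longer {g} {suc e} {T} {B} ly _ pieces (t , T≡) eq with length (pow g (suc e)) ≤? length B
... | no  G≰B = ≰⇒> G≰B
... | yes G≤B with ++-split (pow g (suc e)) _ B _ eq G≤B
... | m , B≡ , _ = ⊥-elim (lyndon-¬prefix ly pieces (pow g e ++ m ++ t , T≡′))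
  where
  T≡′ : T ≡ g ++ pow g e ++ m ++ t
  T≡′ = begin
    T                           ≡⟨ T≡ ⟩
    B ++ t                      ≡⟨ cong (_++ t) B≡ ⟩
    ((g ++ pow g e) ++ m) ++ t  ≡⟨ ++-assoc (g ++ pow g e) m t ⟩
    (g ++ pow g e) ++ m ++ t    ≡⟨ ++-assoc g (pow g e) (m ++ t) ⟩
    g ++ pow g e ++ m ++ t      ∎
    where open ≡-Reasoning

drop-length-++ : ∀ {A : Set} (xs ys : List A) → drop (length xs) (xs ++ ys) ≡ ys
drop-length-++ []       ys = refl
drop-length-++ (x ∷ xs) ys = drop-length-++ xs ys

OccursAt⇒Prefix-drop : ∀ {w s q} → OccursAt w s q → Prefix w (drop q s)
OccursAt⇒Prefix-drop {w} (u , v , refl , refl) = v , drop-length-++ u (w ++ v)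

OccursAt⇒≤length : ∀ {w s q} → OccursAt w s q → q + length w ≤ length s
OccursAt⇒≤length {w} (u , v , refl , refl) = begin
  length u + length w              ≤⟨ m≤m+n _ (length v) ⟩
  length u + length w + length v   ≡⟨ +-assoc (length u) (length w) (length v) ⟩
  length u + (length w + length v) ≡⟨ cong (length u +_) (sym (length-++ w)) ⟩
  length u + length (w ++ v)       ≡⟨ sym (length-++ u) ⟩
  length (u ++ w ++ v)             ∎
  where open ≤-Reasoning

OccursAt-++ˡ : ∀ {u w s q} → OccursAt (u ++ w) s q → OccursAt u s q
OccursAt-++ˡ {u} {w} (U , V , U≡ , s≡) = U , w ++ V , U≡ , trans s≡ (cong (U ++_) (++-assoc u w V))

OccursAt-++ʳ : ∀ {u w s q} → OccursAt (u ++ w) s q → OccursAt w s (q + length u)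
OccursAt-++ʳ {u} {w} (U , V , refl , s≡) =
  U ++ u , V , length-++ U , trans s≡ (trans (cong (U ++_) (++-assoc u w V)) (sym (++-assoc U u (w ++ V))))

OccursAt-aligned : ∀ {u w s q} → OccursAt u s q → OccursAt w s q → length u ≤ length w → Prefix u w
OccursAt-aligned {u} {w} occ₁ occ₂ u≤w with OccursAt⇒Prefix-drop occ₁ | OccursAt⇒Prefix-drop occ₂
... | v₁ , eq₁ | v₂ , eq₂ with ++-split u v₁ w v₂ (trans (sym eq₁) eq₂) u≤w
... | m , w≡ , _ = m , w≡

OccursAt-transfer : ∀ {u w s t a o} → OccursAt u s t → OccursAt u s a → OccursAt w s (t + o) →
                    o + length w ≤ length u → OccursAt w s (a + o)
OccursAt-transfer {u} {w} {s} {t} {a} {o} occₜ occₐ occw o+w≤u =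
  subst (λ n → OccursAt w s (a + n)) |x|≡o
    (OccursAt-++ˡ (subst (λ v → OccursAt v s (a + length x)) (proj₂ w≼r) (split occₐ)))
  where
  x = take o u
  r = drop o u
  o≤u : o ≤ length u
  o≤u = ≤-trans (m≤m+n o (length w)) o+w≤u
  |x|≡o : length x ≡ o
  |x|≡o = trans (length-take o u) (m≤n⇒m⊓n≡m o≤u)
  split : ∀ {n} → OccursAt u s n → OccursAt r s (n + length x)
  split occ = OccursAt-++ʳ (subst (λ v → OccursAt v s _) (sym (take++drop≡id o u)) occ)
  o+|r|≡|u| : o + length r ≡ length u
  o+|r|≡|u| = trans (cong (o +_) (length-drop o u)) (m+[n∸m]≡n o≤u)
  w≼r : Prefix w r
  w≼r = OccursAt-aligned occw (subst (λ n → OccursAt r s (t + n)) |x|≡o (split occₜ))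
          (+-cancelˡ-≤ o _ _ (subst (o + length w ≤_) (sym o+|r|≡|u|) o+w≤u))

-- Positions are absolute: the phrases ps start at position length P.
record PhraseCovering (P : Str) (ps : List Str) (X : ℕ) : Set where
  field
    before phrase after : Str
    split    : P ++ concat ps ≡ before ++ phrase ++ after
    boundary : length before ∈ starts (length P) ps
    start≤X  : length before ≤ X
    X<end    : X < length before + length phrase
    earlier  : length phrase ≡ 1 ⊎ Substr phrase before

phrase-covering : ∀ P ps → LZFrom P ps → ∀ X → length P ≤ X → X < length (P ++ concat ps) →
                  PhraseCovering P ps X
phrase-covering P [] _ X P≤X X<|P| = ⊥-elim (<⇒≱ (subst (λ w → X < length w) (++-identityʳ P) X<|P|) P≤X)
phrase-covering P (x ∷ ps) (step , lz) X P≤X X<|Ps| with X <? length (P ++ x)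
... | yes X<Px = record
  { before = P ; phrase = x ; after = concat ps
  ; split = refl ; boundary = here refl ; start≤X = P≤X
  ; X<end = subst (X <_) (length-++ P) X<Px
  ; earlier = earlier step
  }
  where
  earlier : LZStep P x (concat (x ∷ ps)) → length x ≡ 1 ⊎ Substr x P
  earlier (inj₁ (_ , refl , _)) = inj₁ refl
  earlier (inj₂ (_ , x⊑P , _))  = inj₂ x⊑P
... | no X≮Px = record
  { before = before ; phrase = phrase ; after = after
  ; split = trans (sym (++-assoc P x (concat ps))) split
  ; boundary = there (subst (λ n → length before ∈ starts n ps) (length-++ P) boundary)
  ; start≤X = start≤X ; X<end = X<end ; earlier = earlier
  }
  where
  open PhraseCovering
    (phrase-covering (P ++ x) ps lz X (≮⇒≥ X≮Px)
      (subst (λ w → X < length w) (sym (++-assoc P x (concat ps))) X<|Ps|))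

BoundaryIn : List Str → ℕ → ℕ → Set
BoundaryIn ps lo hi = Σ ℕ λ b → b ∈ phraseBoundaries ps × lo ≤ b × b < hi

-- a + ℓ ≤ t : an earlier copy (at a) of a phrase of length ℓ starting at t;
-- t + o ≡ E : position E lies o places into the phrase; E + B ≤ t + ℓ : the phrase covers [E, E + B).
earlier-copy-before : ∀ {a ℓ t o q E B} → a + ℓ ≤ t → t + o ≡ E → E + B ≤ t + ℓ → t < q + B → a + o < q
earlier-copy-before {a} {ℓ} {t} {o} {q} {E} {B} a+ℓ≤t t+o≡E E+B≤t+ℓ t<q+B =
  +-cancelʳ-< B (a + o) q (≤-<-trans (+-cancelʳ-≤ ℓ _ _ chain) t<q+B)
  where
  chain : a + o + B + ℓ ≤ t + ℓ
  chain = begin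
    a + o + B + ℓ   ≡⟨ rearrange a o B ℓ ⟩
    a + ℓ + (o + B) ≤⟨ +-monoˡ-≤ (o + B) a+ℓ≤t ⟩
    t + (o + B)     ≡⟨ sym (+-assoc t o B) ⟩
    t + o + B       ≡⟨ cong (_+ B) t+o≡E ⟩
    E + B           ≤⟨ E+B≤t+ℓ ⟩
    t + ℓ           ∎
    where
    open ≤-Reasoning
    rearrange : ∀ a o B ℓ → a + o + B + ℓ ≡ a + ℓ + (o + B)
    rearrange = solve-∀

boundary-in-extension : ∀ {s ps G B q} → IsLZ s ps → OccursAt (G ++ B) s q → LeftmostOcc B s q →
  length B < length G → BoundaryIn ps (q + length B) (q + length (G ++ B))
boundary-in-extension {s} {ps} {c ∷ G′} {B} {q} (ps≡s , lz) occGB (_ , leftmost) B<G =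
  length before , boundary , qB≤t , ≤-<-trans start≤X X<end-GB
  where
  G = c ∷ G′
  X = q + length (G′ ++ B)
  X<end-GB : X < q + length (G ++ B)
  X<end-GB = +-monoʳ-< q ≤-refl
  X<|s| : X < length ([] ++ concat ps)
  X<|s| = <-≤-trans X<end-GB
            (subst (λ w → q + length (G ++ B) ≤ length w) (sym ps≡s) (OccursAt⇒≤length occGB))
  open PhraseCovering (phrase-covering [] ps lz X z≤n X<|s|)
  t = length before
  s≡ : s ≡ before ++ phrase ++ after
  s≡ = trans (sym ps≡s) split
  qB≤X : q + length B ≤ X
  qB≤X = +-monoʳ-≤ q (subst (length B ≤_) (sym (length-++ G′)) (m≤n+m (length B) (length G′)))
  no-earlier-copy : t < q + length B → length phrase ≡ 1 ⊎ Substr phrase before → ⊥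
  no-earlier-copy t<qB (inj₁ |phrase|≡1) =
    <⇒≱ t<qB (≤-trans qB≤X (m<1+n⇒m≤n (subst (X <_) (trans (cong (t +_) |phrase|≡1) (+-comm t 1)) X<end)))
  no-earlier-copy t<qB (inj₂ (α , β , before≡)) =
    <⇒≱ (earlier-copy-before a+ℓ≤t t+o≡E E+B≤t+ℓ t<qB) q≤a+o
    where
    E = q + length G
    a+ℓ≤t : length α + length phrase ≤ t
    a+ℓ≤t = OccursAt⇒≤length (α , β , refl , before≡)
    t≤E : t ≤ E
    t≤E = ≤-trans (<⇒≤ t<qB) (+-monoʳ-≤ q (<⇒≤ B<G))
    o = proj₁ (m≤n⇒∃[o]m+o≡n t≤E)
    t+o≡E : t + o ≡ E
    t+o≡E = proj₂ (m≤n⇒∃[o]m+o≡n t≤E)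
    E+B≡1+X : E + length B ≡ suc X
    E+B≡1+X = begin
      q + suc (length G′) + length B   ≡⟨ +-assoc q (suc (length G′)) (length B) ⟩
      q + suc (length G′ + length B)   ≡⟨ cong (λ n → q + suc n) (sym (length-++ G′)) ⟩
      q + suc (length (G′ ++ B))       ≡⟨ +-suc q (length (G′ ++ B)) ⟩
      suc X                            ∎
      where open ≡-Reasoning
    E+B≤t+ℓ : E + length B ≤ t + length phrase
    E+B≤t+ℓ = subst (_≤ t + length phrase) (sym E+B≡1+X) X<end
    o+B≤ℓ : o + length B ≤ length phrase
    o+B≤ℓ = +-cancelˡ-≤ t _ _
              (subst (_≤ t + length phrase) (trans (cong (_+ length B) (sym t+o≡E)) (+-assoc t o (length B))) E+B≤t+ℓ)
    occ-phrase-t : OccursAt phrase s t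
    occ-phrase-t = before , after , refl , s≡
    occ-phrase-a : OccursAt phrase s (length α)
    occ-phrase-a = OccursAt-++ˡ (OccursAt-++ʳ {α}
                     (subst (λ w → OccursAt w s 0) before≡ ([] , phrase ++ after , refl , s≡)))
    occ-B-a+o : OccursAt B s (length α + o)
    occ-B-a+o = OccursAt-transfer occ-phrase-t occ-phrase-a
                  (subst (OccursAt B s) (sym t+o≡E) (OccursAt-++ʳ occGB)) o+B≤ℓ
    q≤a+o : q ≤ length α + o
    q≤a+o = leftmost _ occ-B-a+o
  qB≤t : q + length B ≤ t
  qB≤t = ≮⇒≥ λ t<qB → no-earlier-copy t<qB earlier

drop-∷ : ∀ {A : Set} k (xs : List A) → k < length xs →
         Σ A λ y → Σ (List A) λ ys → drop k xs ≡ y ∷ ys × drop (suc k) xs ≡ ys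
drop-∷ zero    (x ∷ xs) _        = x , xs , refl , refl
drop-∷ (suc k) (x ∷ xs) (s≤s k<) = drop-∷ k xs k<

block-drop : ∀ fs k n {rest} → drop k fs ≡ rest → block (runs fs) k n ≡ concat (take n (runs rest))
block-drop fs k n dropk≡ = cong (λ Fs → concat (take n Fs)) (trans (drop-map k fs) (cong runs dropk≡))

concat-take-Prefix : ∀ n (xss : List Str) → Prefix (concat (take n xss)) (concat xss)
concat-take-Prefix n xss =
  concat (drop n xss) , trans (cong concat (sym (take++drop≡id n xss))) (sym (concat-++ (take n xss) (drop n xss)))

OccursAt-same-start : ∀ {u w s q} → OccursAt u s q → OccursAt w s q → Σ Str λ x → Σ Str λ y → u ++ x ≡ w ++ y
OccursAt-same-start occᵤ occw with OccursAt⇒Prefix-drop occᵤ | OccursAt⇒Prefix-drop occw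
... | x , eqᵤ | y , eqw = x , y , trans (sym eqᵤ) eqw

run-boundary : ∀ {s fs ps q} k n → IsLyndonFactorization s fs → IsLZ s ps → k < length fs →
  OccursAt (block (runs fs) k (suc n)) s q → LeftmostOcc (block (runs fs) (suc k) n) s q →
  BoundaryIn ps (q + length (block (runs fs) (suc k) n)) (q + length (block (runs fs) k (suc n)))
run-boundary {s} {fs} {ps} {q} k n (factors , decreasing , _) lz k<|fs| occ leftmost
  with drop-∷ k fs k<|fs|
... | (g , e) , rest , dropk≡ , dropsk≡ =
  subst₂ (λ B GB → BoundaryIn ps (q + length B) (q + length GB)) (sym Fk+1≡) (sym Fk≡)
    (boundary-in-extension lz occ′ leftmost′ (run-longer lyndon 1≤e (runs-Concat≺ rest below)
      (concat-take-Prefix n (runs rest)) (proj₂ (proj₂ aligned))))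
  where
  Fk≡ = block-drop fs k (suc n) dropk≡
  Fk+1≡ = block-drop fs (suc k) n dropsk≡
  occ′ = subst (λ w → OccursAt w s q) Fk≡ occ
  leftmost′ = subst (λ w → LeftmostOcc w s q) Fk+1≡ leftmost
  aligned : Σ Str λ x → Σ Str λ y → pow g e ++ x ≡ concat (take n (runs rest)) ++ y
  aligned with OccursAt-same-start occ′ (proj₁ leftmost′)
  ... | x , y , eq = _ ++ x , y , trans (sym (++-assoc (pow g e) _ x)) eq
  lyndon×1≤e = All.head (subst (All _) dropk≡ (All.drop⁺ k factors))
  lyndon = proj₁ lyndon×1≤e
  1≤e = proj₂ lyndon×1≤e
  below : All (λ fe → proj₁ fe ≺ g) rest
  below = AllPairs.head (subst (AllPairs _) dropk≡
            (AllPairs.drop⁺ k (Linked⇒AllPairs (λ x≻y y≻z → ≺-trans y≻z x≻y) decreasing)))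

module _ (P : ℕ → Set) (e : ℕ → ℕ) where

  HitsSteps : ℕ → Set
  HitsSteps n = ∀ j → j < n → Σ ℕ λ b → P b × e (suc j) ≤ b × b < e j

  HitsSteps-pred : ∀ {n} → HitsSteps (suc n) → HitsSteps n
  HitsSteps-pred nested j j<n = nested j (m<n⇒m<1+n j<n)

  HitsSteps⇒antitone : ∀ n → HitsSteps n → e n ≤ e 0
  HitsSteps⇒antitone zero    _      = ≤-refl
  HitsSteps⇒antitone (suc n) nested with nested n ≤-refl
  ... | _ , _ , lo , hi = ≤-trans (≤-trans lo (<⇒≤ hi)) (HitsSteps⇒antitone n (HitsSteps-pred nested))

  HitsSteps⇒distinct : ∀ n → HitsSteps n →
    Σ (List ℕ) λ bs → Unique bs × length bs ≡ n × All (λ b → P b × e n ≤ b × b < e 0) bs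
  HitsSteps⇒distinct zero    _      = [] , [] , refl , []
  HitsSteps⇒distinct (suc n) nested = extend (nested n ≤-refl) (HitsSteps⇒distinct n (HitsSteps-pred nested))
    where
    extend : Σ ℕ (λ b → P b × e (suc n) ≤ b × b < e n) →
             Σ (List ℕ) (λ bs → Unique bs × length bs ≡ n × All (λ b → P b × e n ≤ b × b < e 0) bs) →
             Σ (List ℕ) λ bs → Unique bs × length bs ≡ suc n × All (λ b → P b × e (suc n) ≤ b × b < e 0) bs
    extend (b , Pb , lo , hi) (bs , unique , len , inside) =
      b ∷ bs ,
      All.map (λ (_ , en≤b′ , _) → <⇒≢ (<-≤-trans hi en≤b′)) inside ∷ unique ,
      cong suc len ,
      (Pb , lo , <-≤-trans hi (HitsSteps⇒antitone n (HitsSteps-pred nested))) ∷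
      All.map (λ (Pb′ , en≤b′ , b′<e0) → Pb′ , ≤-trans (≤-trans lo (<⇒≤ hi)) en≤b′ , b′<e0) inside

m∸n≡1+[m∸1+n] : ∀ m n → n < m → m ∸ n ≡ suc (m ∸ suc n)
m∸n≡1+[m∸1+n] (suc m) zero    _         = refl
m∸n≡1+[m∸1+n] (suc m) (suc n) (s≤s n<m) = m∸n≡1+[m∸1+n] m n n<m

suffix-blocks-hit-boundaries : ∀ {s fs ps q} i N n → IsLyndonFactorization s fs → IsLZ s ps →
  i + N ≤ length fs → n < N →
  (∀ k → k < suc n → LeftmostOcc (block (runs fs) (i + k) (N ∸ k)) s q) →
  HitsSteps (_∈ phraseBoundaries ps) (λ k → q + length (block (runs fs) (i + k) (N ∸ k))) n
suffix-blocks-hit-boundaries {s} {fs} {ps} {q} i N n factorisation lz bound n<N leftmost j j<n =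
  subst₂ (BoundaryIn ps)
    (cong (λ k → q + length (block (runs fs) k (N ∸ suc j))) (sym (+-suc i j)))
    (cong (λ m → q + length (block (runs fs) (i + j) m)) (sym N∸j≡))
    (run-boundary (i + j) (N ∸ suc j) factorisation lz (<-≤-trans (+-monoʳ-< i j<N) bound)
      (subst (λ m → OccursAt (block (runs fs) (i + j) m) s q) N∸j≡ (proj₁ (leftmost j (m<n⇒m<1+n j<n))))
      (subst (λ k → LeftmostOcc (block (runs fs) k (N ∸ suc j)) s q) (+-suc i j) (leftmost (suc j) (s≤s j<n))))
  where
  j<N : j < N
  j<N = <-trans j<n n<N
  N∸j≡ : N ∸ j ≡ suc (N ∸ suc j)
  N∸j≡ = m∸n≡1+[m∸1+n] N j j<N

corollary1 : (s : Str) (fs : List (Str × ℕ)) (ps : List Str)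
    → IsLyndonFactorization s fs
    → IsLZ s ps
    → (i d p q : ℕ)
    → 1 ≤ d → 2 ≤ p → i + (d + p ∸ 1) ≤ length fs
    → LeftmostOcc (block (runs fs) i (d + p ∸ 1)) s q
    → (∀ k → k < p → LeftmostOcc (block (runs fs) (i + k) (d + p ∸ 1 ∸ k)) s q)
    → Σ (List ℕ) λ bs → Unique bs × p ∸ 1 ≤ length bs
        × All (λ b → b ∈ phraseBoundaries ps
                 × q + length (block (runs fs) (i + p ∸ 1) d) ≤ b
                 × b < q + length (block (runs fs) i (d + p ∸ 1))) bs
corollary1 s fs ps factorisation lz i (suc d) (suc n) q (s≤s z≤n) (s≤s _) bound _ leftmost =
  let bs , unique , len , inside = HitsSteps⇒distinct _ end n
                                     (suffix-blocks-hit-boundaries i N n factorisation lz bound (m≤n+m (suc n) d) leftmost)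
  in bs , unique , ≤-reflexive (sym len) , All.map relabel inside
  where
  N = d + suc n
  end : ℕ → ℕ
  end k = q + length (block (runs fs) (i + k) (N ∸ k))
  lo≡ : end n ≡ q + length (block (runs fs) (i + suc n ∸ 1) (suc d))
  lo≡ = cong₂ (λ k m → q + length (block (runs fs) k m))
          (cong (_∸ 1) (sym (+-suc i n))) (trans (cong (_∸ n) (+-suc d n)) (m+n∸n≡m (suc d) n))
  hi≡ : end 0 ≡ q + length (block (runs fs) i N)
  hi≡ = cong (λ k → q + length (block (runs fs) k N)) (+-identityʳ i)
  relabel : ∀ {b} → b ∈ phraseBoundaries ps × end n ≤ b × b < end 0 →
            b ∈ phraseBoundaries ps × q + length (block (runs fs) (i + suc n ∸ 1) (suc d)) ≤ b
              × b < q + length (block (runs fs) i N)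
  relabel {b} (boundary , lo , hi) = boundary , subst (_≤ b) lo≡ lo , subst (b <_) hi≡ hi
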